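{- If $\mathbf{w}$ is an even closed walk in a signed graph $(G,\tau)$, then $B_{\mathbf{w}}\in I_{(G,\tau)}$.
   Context: Graphs are finite and simple. A sign of $G$ is a function $\tau$ from the pairs $(e,v)$ ($v$ an endpoint of edge $e$) to $\{1,-1\}$. The incidence matrix $A=A(G,\tau)$ has rows indexed by vertices, columns by edges $e_1,\dots,e_m$, entry $\tau(e,v)$ if $v\in e$ and $0$ otherwise. For a field $K$, $I_{(G,\tau)}\subseteq K[e_1,\dots,e_m]$ is generated by all $\mathbb{e}^{\mathbb{b}^+}-\mathbb{e}^{\mathbb{b}^- }$ with $\mathbb{b}\in\mathbb{Z}^m$, $A\mathbb{b}=0$, where $\mathbb{e}^{\mathbb{x}}=\prod e_i^{x_i}$, $\mathbb{b}^+_i=\max\{b_i,0\}$, $\mathbb{b}^-_i=-\min\{b_i,0\}$. For a closed walk $\mathbf{w}:v_1e_1v_2\cdots e_tv_1$ ($e_i=v_iv_{i+1}$, $t\ge 2$), a vertex term $v_i$ is unbalanced if $\tau(e_{i-1},v_i)\tau(e_i,v_i)=1$ (indices cyclic); $\mathbf{w}$ is even if the number of unbalanced vertex terms is even. A balanced section is a maximal section (consecutive terms, cyclically) with no internal unbalanced vertex term. If $\mathbf{w}$ is even with an unbalanced vertex term, starting at one, it decomposes uniquely into consecutive balanced sections $\mathbf{w}_0,\dots,\mathbf{w}_{2k-1}$, and $B_{\mathbf{w}}=\prod_{i\text{ even}}\prod_{e\in E(\mathbf{w}_i)}e-\prod_{i\text{ odd}}\prod_{e\in E(\mathbf{w}_i)}e$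 (edges with multiplicity); if $\mathbf{w}$ has no unbalanced vertex term, $B_{\mathbf{w}}=\prod_{e\in E(\mathbf{w})}e-1$. $B_{\mathbf{w}}$ is determined up to sign. -}

module Defs where

open import Level using (Level; _⊔_)
open import Data.Nat as ℕ using (ℕ; zero; suc; _≤_; _<?_; _≤?_; s≤s)
open import Data.Integer as ℤ using (ℤ; +_; -[1+_]; _◃_)
open import Data.Sign as Sign using (Sign)
open import Data.Fin as Fin using (Fin; toℕ; fromℕ; fromℕ<; inject₁)
open import Data.Fin.Properties using (all?)
open import Data.Vec as Vec using (Vec; tabulate; lookup; zipWith)
open import Data.Vec.Properties using (≡-dec)
open import Data.List as List using (List; []; _∷_; _++_; map; foldr; allFin; filter; length; concatMap)
open import Data.Bool using (Bool; true; false; _∧_; if_then_else_)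
open import Data.Product using (Σ; _×_; _,_; proj₁; proj₂; ∃)
open import Data.Sum using (_⊎_)
open import Relation.Nullary using (¬_; does; yes; no)
open import Relation.Binary.PropositionalEquality using (_≡_; _≢_)
open import Algebra.Bundles using (CommutativeRing)

record IsField {c ℓ} (K : CommutativeRing c ℓ) : Set (c ⊔ ℓ) where
  open CommutativeRing K
  field
    1≉0     : ¬ (1# ≈ 0#)
    inverse : ∀ x → ¬ (x ≈ 0#) → Σ Carrier (λ y → (x * y) ≈ 1#)

record SimpleGraph (n m : ℕ) : Set where
  field
    ends     : Fin m → Fin n × Fin n
    loopless : ∀ i → proj₁ (ends i) ≢ proj₂ (ends i)
    noMulti  : ∀ i j → ( (proj₁ (ends i) ≡ proj₁ (ends j) × proj₂ (ends i) ≡ proj₂ (ends j))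
                       ⊎ (proj₁ (ends i) ≡ proj₂ (ends j) × proj₂ (ends i) ≡ proj₁ (ends j)) )
                     → i ≡ j

  isEnd : Fin m → Fin n → Bool
  isEnd i v = does (proj₁ (ends i) Fin.≟ v) Data.Bool.∨ does (proj₂ (ends i) Fin.≟ v)
    where import Data.Bool

  Joins : Fin m → Fin n → Fin n → Set
  Joins i u v = (proj₁ (ends i) ≡ u × proj₂ (ends i) ≡ v) ⊎ (proj₁ (ends i) ≡ v × proj₂ (ends i) ≡ u)

-- A sign: only its values τ e v with v an endpoint of e matter.
SignFn : ℕ → ℕ → Set
SignFn n m = Fin m → Fin n → Sign

module _ {n m : ℕ} (G : SimpleGraph n m) (τ : SignFn n m) where
  open SimpleGraph G

  incidence : Fin n → Fin m → ℤ
  incidence v i = if isEnd i v then (τ i v ◃ 1) else + 0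

  InKernel : Vec ℤ m → Set
  InKernel b = ∀ v → List.foldr ℤ._+_ (+ 0)
                       (List.map (λ i → incidence v i ℤ.* lookup b i) (allFin m)) ≡ + 0

-- Polynomials in K[e_1,…,e_m]: finite lists of terms (coefficient, exponent vector),
-- compared by their coefficient functions.

Monomial : ℕ → Set
Monomial m = Vec ℕ m

module Poly {c ℓ} (K : CommutativeRing c ℓ) (m : ℕ) where
  open CommutativeRing K

  P : Set c
  P = List (Carrier × Monomial m)

  coeff : P → Monomial m → Carrier
  coeff []             α = 0#
  coeff ((a , β) ∷ ts) α = if does (≡-dec ℕ._≟_ β α) then a + coeff ts α else coeff ts α

  _≈P_ : P → P → Set ℓ
  p ≈P q = ∀ α → coeff p α ≈ coeff q α

  _+P_ : P → P → P
  p +P q = p ++ q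

  -P_ : P → P
  -P p = map (λ t → (- proj₁ t , proj₂ t)) p

  _*P_ : P → P → P
  p *P q = concatMap (λ s → map (λ t → (proj₁ s * proj₁ t , zipWith ℕ._+_ (proj₂ s) (proj₂ t))) q) p

  0P : P
  0P = []

  mono : Monomial m → P
  mono α = (1# , α) ∷ []

  binom : Monomial m → Monomial m → P
  binom α β = mono α +P (-P mono β)

  InIdeal : ∀ {ℓ'} → (P → Set ℓ') → P → Set (c ⊔ ℓ ⊔ ℓ')
  InIdeal Gen f = Σ (List (Σ (P × P) (λ gs → Gen (proj₂ gs))))
                    (λ L → f ≈P foldr (λ x acc → (proj₁ (proj₁ x) *P proj₂ (proj₁ x)) +P acc) 0P L)

pos neg : ℤ → ℕ
pos (+ k) = k
pos -[1+ k ] = 0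
neg (+ k) = 0
neg -[1+ k ] = suc k

module _ {c ℓ} (K : CommutativeRing c ℓ) {n m : ℕ} (G : SimpleGraph n m) (τ : SignFn n m) where
  open Poly K m

  IsToricGen : P → Set c
  IsToricGen f = Σ (Vec ℤ m) (λ b → InKernel G τ b × f ≡ binom (Vec.map pos b) (Vec.map neg b))

  InI : P → Set (c ⊔ ℓ)
  InI = InIdeal IsToricGen

-- Closed walks v_1 e_1 v_2 ⋯ e_t v_1, t = suc k ≥ 2, indexed by Fin t (0-based, cyclic)

nextF : ∀ {k} → Fin (suc k) → Fin (suc k)
nextF {k} i with suc (toℕ i) <? suc k
... | yes p = fromℕ< p
... | no _  = Fin.zero

prevF : ∀ {k} → Fin (suc k) → Fin (suc k)
prevF {k} Fin.zero    = fromℕ k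
prevF {k} (Fin.suc j) = inject₁ j

record ClosedWalk {n m : ℕ} (G : SimpleGraph n m) : Set where
  field
    k     : ℕ
    2≤t   : 1 ≤ k                     -- t = suc k ≥ 2
    vert  : Fin (suc k) → Fin n
    edge  : Fin (suc k) → Fin m
    joins : ∀ i → SimpleGraph.Joins G (edge i) (vert i) (vert (nextF i))

module _ {n m : ℕ} {G : SimpleGraph n m} (τ : SignFn n m) (w : ClosedWalk G) where
  open ClosedWalk w

  unbalanced : Fin (suc k) → Bool
  unbalanced i = does ((τ (edge (prevF i)) (vert i) Sign.* τ (edge i) (vert i)) Sign.≟ Sign.+)

  isEven : ℕ → Bool
  isEven zero = true
  isEven (suc j) = Data.Bool.not (isEven j)
    where import Data.Bool

  numUnbalanced : ℕ
  numUnbalanced = length (filter (λ i → unbalanced i Data.Bool.≟ true) (allFin (suc k)))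
    where import Data.Bool

  EvenWalk : Set
  EvenWalk = isEven numUnbalanced ≡ true

  -- index of the balanced section containing edge term e_i (counted mod 2):
  -- number of unbalanced vertex terms among v_1,…,v_i (i.e. indices 0..i)
  sectionCount : Fin (suc k) → ℕ
  sectionCount i = length (filter (λ j → (does (toℕ j ≤? toℕ i) ∧ unbalanced j) Data.Bool.≟ true)
                                  (allFin (suc k)))
    where import Data.Bool

  -- exponent vector of ∏ of the edges in sections of parity p (edges with multiplicity)
  sectionExp : Bool → Monomial m
  sectionExp p = tabulate (λ e → length (filter
                   (λ i → ((does (edge i Fin.≟ e)) ∧ does (isEven (sectionCount i) Data.Bool.≟ p)) Data.Bool.≟ true)
                   (allFin (suc k))))
    where import Data.Bool

  -- B_w = ∏_{even sections} e − ∏_{odd sections} e   (= ∏ e − 1 if no unbalanced term)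
  Bw : ∀ {c ℓ} (K : CommutativeRing c ℓ) → Poly.P K m
  Bw K = Poly.binom K m (sectionExp true) (sectionExp false)

-- Give the edge term e_i of w the sign σ_i = +1 or −1 according to the parity of its balanced
-- section, and let b_e = Σ_{e_i = e} σ_i. At a vertex v the column sum of A b collects, for every
-- vertex term v_i = v, the contribution τ(e_{i-1},v_i) σ_{i-1} + τ(e_i,v_i) σ_i of the two edge
-- terms meeting there. The section parity flips exactly at unbalanced vertex terms, so each such
-- contribution vanishes; at v_1, where the walk closes up, this needs the total number of unbalanced
-- vertex terms to be even. Hence A b = 0, and B_w = e^γ (e^{b⁺} − e^{b⁻}), where γ_e is the smaller
-- of the numbers of occurrences of e in even and in odd sections.

module Submission where

open import Defs
open import Algebra.Bundles using (CommutativeRing)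
open import Data.Bool as Bool using (Bool; true; false; _∧_; _∨_; _xor_; if_then_else_)
open import Data.Empty using (⊥-elim)
open import Data.Fin as Fin using (Fin; toℕ; fromℕ; inject₁)
import Data.Fin.Properties as FinP
open import Data.Integer as ℤ using (ℤ; +_; -[1+_]; _◃_; _⊖_; _+_; _*_)
import Data.Integer.Properties as ℤP
open import Data.List as List using ([]; _∷_; filter; length; allFin)
open import Data.Nat as ℕ using (ℕ; zero; suc; _≤?_; _<?_; s≤s)
import Data.Nat.Properties as ℕP
open import Data.Product using (Σ; _×_; _,_; proj₂)
open import Data.Sign as Sign using (Sign)
open import Data.Sum using (inj₁; inj₂)
open import Data.Vec as Vec using (Vec; tabulate; lookup; zipWith)
open import Data.Vec.Properties using (≡-dec; tabulate-cong; tabulate-∘; lookup∘tabulate)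
open import Function using (_∘_; id)
open import Function.Bundles using (mk⇔)
open import Relation.Nullary using (does; yes; no; contradiction)
open import Relation.Nullary.Decidable using (dec-true; dec-false; does-⇔)
open import Relation.Binary.PropositionalEquality

open import Algebra.Properties.Semiring.Sum ℤP.+-*-semiring
  using (sum; sum-syntax; sum-cong-≗; sum-replicate-zero; sum-init-last; ∑-distrib-+; ∑-comm; *-distribˡ-sum)

open ≡-Reasoning

onlyAt : ∀ {n} → Fin n → Fin n → ℤ → ℤ
onlyAt a i z = if does (a Fin.≟ i) then z else + 0

*-distribˡ-onlyAt : ∀ {n} (c : ℤ) (a i : Fin n) (z : ℤ) → c * onlyAt a i z ≡ onlyAt a i (c * z)
*-distribˡ-onlyAt c a i z with does (a Fin.≟ i)
... | true  = refl
... | false = ℤP.*-zeroʳ c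

∑-onlyAt : ∀ {n} (a : Fin n) (f : Fin n → ℤ) → ∑[ i < n ] onlyAt a i (f i) ≡ f a
∑-onlyAt {suc n} Fin.zero    f = trans (cong (ℤ._+_ (f Fin.zero)) (sum-replicate-zero n)) (ℤP.+-identityʳ _)
∑-onlyAt {suc n} (Fin.suc a) f = trans (ℤP.+-identityˡ _) (∑-onlyAt a (f ∘ Fin.suc))

onlyAt-∨ : ∀ {n} (x y v : Fin n) (z : ℤ) → x ≢ y →
           (if does (x Fin.≟ v) ∨ does (y Fin.≟ v) then z else + 0) ≡ onlyAt x v z + onlyAt y v z
onlyAt-∨ x y v z x≢y with x Fin.≟ v | y Fin.≟ v
... | yes refl | yes refl = contradiction refl x≢y
... | yes _    | no _     = sym (ℤP.+-identityʳ z)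
... | no _     | yes _    = sym (ℤP.+-identityˡ z)
... | no _     | no _     = refl

foldr-map-allFin : ∀ {n} (f : Fin n → ℤ) → List.foldr _+_ (+ 0) (List.map f (allFin n)) ≡ sum f
foldr-map-allFin f = foldr-map-tabulate f id
  where
  foldr-map-tabulate : ∀ {n n′} (f : Fin n′ → ℤ) (g : Fin n → Fin n′) →
                       List.foldr _+_ (+ 0) (List.map f (List.tabulate g)) ≡ sum (f ∘ g)
  foldr-map-tabulate {zero}  f g = refl
  foldr-map-tabulate {suc n} f g = cong (ℤ._+_ (f (g Fin.zero))) (foldr-map-tabulate f (g ∘ Fin.suc))

nextF-inject₁ : ∀ {k} (j : Fin k) → nextF (inject₁ j) ≡ Fin.suc j
nextF-inject₁ {k} j with suc (toℕ (inject₁ j)) <? suc k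
... | yes p = FinP.toℕ-injective (trans (FinP.toℕ-fromℕ< p) (cong suc (FinP.toℕ-inject₁ j)))
... | no ¬p = ⊥-elim (¬p (s≤s (subst (ℕ._< k) (sym (FinP.toℕ-inject₁ j)) (FinP.toℕ<n j))))

nextF-fromℕ : ∀ k → nextF (fromℕ k) ≡ Fin.zero
nextF-fromℕ k with suc (toℕ (fromℕ k)) <? suc k
... | yes p = ⊥-elim (ℕP.<-irrefl refl (subst (ℕ._< suc k) (cong suc (FinP.toℕ-fromℕ k)) p))
... | no _  = refl

nextF-prevF : ∀ {k} (i : Fin (suc k)) → nextF (prevF i) ≡ i
nextF-prevF {k} Fin.zero    = nextF-fromℕ k
nextF-prevF     (Fin.suc j) = nextF-inject₁ j

∑-prevF : ∀ {k} (f : Fin (suc k) → ℤ) → ∑[ i < suc k ] f (prevF i) ≡ sum f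
∑-prevF {k} f = trans (ℤP.+-comm (f (fromℕ k)) (sum (f ∘ inject₁))) (sym (sum-init-last f))

indicator : Bool → ℕ
indicator b = if b then 1 else 0

count : ∀ {n} → (Fin n → Bool) → ℕ
count {zero}  f = 0
count {suc n} f = indicator (f Fin.zero) ℕ.+ count (f ∘ Fin.suc)

count-cong : ∀ {n} {f g : Fin n → Bool} → (∀ i → f i ≡ g i) → count f ≡ count g
count-cong {zero}  f≗g = refl
count-cong {suc n} f≗g = cong₂ (λ b c → indicator b ℕ.+ c) (f≗g Fin.zero) (count-cong (f≗g ∘ Fin.suc))

count-false : ∀ n → count {n} (λ _ → false) ≡ 0
count-false zero    = refl
count-false (suc n) = count-false n

length-filter-allFin : ∀ {n} (f : Fin n → Bool) →
                       length (filter (λ i → f i Bool.≟ true) (allFin n)) ≡ count f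
length-filter-allFin f = length-filter-tabulate f id
  where
  length-filter-tabulate : ∀ {n n′} (f : Fin n′ → Bool) (g : Fin n → Fin n′) →
                           length (filter (λ i → f i Bool.≟ true) (List.tabulate g)) ≡ count (f ∘ g)
  length-filter-tabulate {zero}  f g = refl
  length-filter-tabulate {suc n} f g with f (g Fin.zero)
  ... | true  = cong suc (length-filter-tabulate f (g ∘ Fin.suc))
  ... | false = length-filter-tabulate f (g ∘ Fin.suc)

countUpTo : ∀ {n} → (Fin n → Bool) → ℕ → ℕ
countUpTo f c = count (λ j → does (toℕ j ≤? c) ∧ f j)

countUpTo-zero : ∀ {n} (f : Fin (suc n) → Bool) → countUpTo f 0 ≡ indicator (f Fin.zero)
countUpTo-zero {n} f = trans (cong (a ℕ.+_) (trans (count-cong beyond) (count-false n))) (ℕP.+-identityʳ a)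
  where
  a : ℕ
  a = indicator (f Fin.zero)
  beyond : ∀ j → does (suc (toℕ j) ≤? 0) ∧ f (Fin.suc j) ≡ false
  beyond j = cong (_∧ f (Fin.suc j)) (dec-false (suc (toℕ j) ≤? 0) λ ())

countUpTo-suc : ∀ {n} (f : Fin (suc n) → Bool) c →
                countUpTo f (suc c) ≡ indicator (f Fin.zero) ℕ.+ countUpTo (f ∘ Fin.suc) c
countUpTo-suc f c =
  cong (indicator (f Fin.zero) ℕ.+_) (count-cong (λ j → cong (_∧ f (Fin.suc j)) (suc≤?suc (toℕ j))))
  where
  suc≤?suc : ∀ a → does (suc a ≤? suc c) ≡ does (a ≤? c)
  suc≤?suc a = does-⇔ (mk⇔ ℕ.s≤s⁻¹ s≤s) (suc a ≤? suc c) (a ≤? c)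

countUpTo-step : ∀ {n} (f : Fin (suc n) → Bool) (j : Fin n) →
                 countUpTo f (suc (toℕ j)) ≡ countUpTo f (toℕ j) ℕ.+ indicator (f (Fin.suc j))
countUpTo-step f Fin.zero = begin
  countUpTo f 1                            ≡⟨ countUpTo-suc f 0 ⟩
  a ℕ.+ countUpTo (f ∘ Fin.suc) 0          ≡⟨ cong (a ℕ.+_) (countUpTo-zero (f ∘ Fin.suc)) ⟩
  a ℕ.+ b                                  ≡⟨ cong (ℕ._+ b) (countUpTo-zero f) ⟨
  countUpTo f 0 ℕ.+ b                      ∎
  where
  a b : ℕ
  a = indicator (f Fin.zero)
  b = indicator (f (Fin.suc Fin.zero))
countUpTo-step f (Fin.suc j) = begin
  countUpTo f (suc (suc (toℕ j)))
    ≡⟨ countUpTo-suc f (suc (toℕ j)) ⟩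
  a ℕ.+ countUpTo (f ∘ Fin.suc) (suc (toℕ j))
    ≡⟨ cong (a ℕ.+_) (countUpTo-step (f ∘ Fin.suc) j) ⟩
  a ℕ.+ (countUpTo (f ∘ Fin.suc) (toℕ j) ℕ.+ b)
    ≡⟨ ℕP.+-assoc a _ b ⟨
  a ℕ.+ countUpTo (f ∘ Fin.suc) (toℕ j) ℕ.+ b
    ≡⟨ cong (ℕ._+ b) (countUpTo-suc f (toℕ j)) ⟨
  countUpTo f (suc (toℕ j)) ℕ.+ b ∎
  where
  a b : ℕ
  a = indicator (f Fin.zero)
  b = indicator (f (Fin.suc (Fin.suc j)))

countUpTo-all : ∀ {n} (f : Fin n → Bool) c → n ℕ.≤ suc c → countUpTo f c ≡ count f
countUpTo-all f c n≤1+c =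
  count-cong (λ j → cong (_∧ f j) (dec-true (toℕ j ≤? c) (j≤c j)))
  where
  j≤c : ∀ j → toℕ j ℕ.≤ c
  j≤c j = ℕ.s≤s⁻¹ (ℕP.≤-trans (FinP.toℕ<n j) n≤1+c)

±1 : Bool → ℤ
±1 true  = + 1
±1 false = -[1+ 0 ]

∑-±1 : ∀ {n} (d p : Fin n → Bool) →
       ∑[ i < n ] (if d i then ±1 (p i) else + 0)
         ≡ count (λ i → d i ∧ does (p i Bool.≟ true)) ⊖ count (λ i → d i ∧ does (p i Bool.≟ false))
∑-±1 {zero}  d p = refl
∑-±1 {suc n} d p = trans (cong (ℤ._+_ (if d Fin.zero then ±1 (p Fin.zero) else + 0))
                               (∑-±1 (d ∘ Fin.suc) (p ∘ Fin.suc)))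
                         (step (d Fin.zero) (p Fin.zero) _ _)
  where
  step : ∀ (b q : Bool) (x y : ℕ) →
         (if b then ±1 q else + 0) + (x ⊖ y)
           ≡ (indicator (b ∧ does (q Bool.≟ true)) ℕ.+ x) ⊖ (indicator (b ∧ does (q Bool.≟ false)) ℕ.+ y)
  step true  true  x y = ℤP.distribʳ-⊖-+-pos 1 x y
  step true  false x y = ℤP.distribʳ-⊖-+-neg 0 x y
  step false q     x y = ℤP.+-identityˡ (x ⊖ y)

±1-xor-cancel : ∀ (a b : Sign) (x : Bool) →
                (a ◃ 1) * ±1 (does ((b Sign.* a) Sign.≟ Sign.+) xor x) + (b ◃ 1) * ±1 x ≡ + 0
±1-xor-cancel Sign.+ Sign.+ true  = refl
±1-xor-cancel Sign.+ Sign.+ false = refl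
±1-xor-cancel Sign.+ Sign.- true  = refl
±1-xor-cancel Sign.+ Sign.- false = refl
±1-xor-cancel Sign.- Sign.+ true  = refl
±1-xor-cancel Sign.- Sign.+ false = refl
±1-xor-cancel Sign.- Sign.- true  = refl
±1-xor-cancel Sign.- Sign.- false = refl

zipWith-tabulate : ∀ {A B C : Set} {n} (f : A → B → C) (g : Fin n → A) (h : Fin n → B) →
                   zipWith f (tabulate g) (tabulate h) ≡ tabulate (λ i → f (g i) (h i))
zipWith-tabulate {n = zero}  f g h = refl
zipWith-tabulate {n = suc n} f g h =
  cong (f (g Fin.zero) (h Fin.zero) Vec.∷_) (zipWith-tabulate f (g ∘ Fin.suc) (h ∘ Fin.suc))

m⊓n+pos[m⊖n]≡m : ∀ m n → m ℕ.⊓ n ℕ.+ pos (m ⊖ n) ≡ m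
m⊓n+pos[m⊖n]≡m zero    zero    = refl
m⊓n+pos[m⊖n]≡m zero    (suc n) = refl
m⊓n+pos[m⊖n]≡m (suc m) zero    = refl
m⊓n+pos[m⊖n]≡m (suc m) (suc n) = trans (cong (λ z → suc (m ℕ.⊓ n ℕ.+ pos z)) (ℤP.[1+m]⊖[1+n]≡m⊖n m n))
                                       (cong suc (m⊓n+pos[m⊖n]≡m m n))

m⊓n+neg[m⊖n]≡n : ∀ m n → m ℕ.⊓ n ℕ.+ neg (m ⊖ n) ≡ n
m⊓n+neg[m⊖n]≡n zero    zero    = refl
m⊓n+neg[m⊖n]≡n zero    (suc n) = refl
m⊓n+neg[m⊖n]≡n (suc m) zero    = refl
m⊓n+neg[m⊖n]≡n (suc m) (suc n) = trans (cong (λ z → suc (m ℕ.⊓ n ℕ.+ neg z)) (ℤP.[1+m]⊖[1+n]≡m⊖n m n))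
                                       (cong suc (m⊓n+neg[m⊖n]≡n m n))

incidence-joins : ∀ {n m} (G : SimpleGraph n m) (τ : SignFn n m) {i : Fin m} {x y : Fin n} →
                  SimpleGraph.Joins G i x y → ∀ v →
                  incidence G τ v i ≡ onlyAt x v (τ i v ◃ 1) + onlyAt y v (τ i v ◃ 1)
incidence-joins G τ {i} (inj₁ (refl , refl)) v = onlyAt-∨ _ _ v (τ i v ◃ 1) (SimpleGraph.loopless G i)
incidence-joins G τ {i} {x} {y} (inj₂ (refl , refl)) v =
  trans (onlyAt-∨ y x v (τ i v ◃ 1) (SimpleGraph.loopless G i)) (ℤP.+-comm (onlyAt y v _) (onlyAt x v _))

module _ {n m : ℕ} {G : SimpleGraph n m} (τ : SignFn n m) (w : ClosedWalk G) where
  open ClosedWalk w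

  edgeTermVector : (Fin (suc k) → ℤ) → Vec ℤ m
  edgeTermVector σ = tabulate (λ e → ∑[ i < suc k ] onlyAt (edge i) e (σ i))

  CancelsAtVertexTerms : (Fin (suc k) → ℤ) → Set
  CancelsAtVertexTerms σ = ∀ i →
    (τ (edge i) (vert i) ◃ 1) * σ i + (τ (edge (prevF i)) (vert i) ◃ 1) * σ (prevF i) ≡ + 0

  edgeTermVector-inKernel : ∀ σ → CancelsAtVertexTerms σ → InKernel G τ (edgeTermVector σ)
  edgeTermVector-inKernel σ cancels v = begin
    List.foldr _+_ (+ 0) (List.map (λ e → a e * lookup (edgeTermVector σ) e) (allFin m))
      ≡⟨ foldr-map-allFin (λ e → a e * lookup (edgeTermVector σ) e) ⟩
    ∑[ e < m ] (a e * lookup (edgeTermVector σ) e)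
      ≡⟨ sum-cong-≗ (λ e → cong (a e *_) (lookup∘tabulate b e)) ⟩
    ∑[ e < m ] (a e * b e)
      ≡⟨ sum-cong-≗ (λ e → trans (*-distribˡ-sum (a e) (λ i → onlyAt (edge i) e (σ i)))
                                 (sum-cong-≗ (λ i → *-distribˡ-onlyAt (a e) (edge i) e (σ i)))) ⟩
    ∑[ e < m ] ∑[ i < suc k ] (onlyAt (edge i) e (a e * σ i))
      ≡⟨ ∑-comm (λ e i → onlyAt (edge i) e (a e * σ i)) ⟩
    ∑[ i < suc k ] ∑[ e < m ] (onlyAt (edge i) e (a e * σ i))
      ≡⟨ sum-cong-≗ (λ i → ∑-onlyAt (edge i) (λ e → a e * σ i)) ⟩
    ∑[ i < suc k ] (a (edge i) * σ i)
      ≡⟨ sum-cong-≗ (λ i → trans (cong (_* σ i) (incidence-joins G τ (joins i) v))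
                                 (ℤP.*-distribʳ-+ (σ i) (tailEntry i) (headEntry i))) ⟩
    ∑[ i < suc k ] (atTail i + atHead i)
      ≡⟨ ∑-distrib-+ atTail atHead ⟩
    sum atTail + sum atHead
      ≡⟨ cong (ℤ._+_ (sum atTail)) (∑-prevF atHead) ⟨
    sum atTail + ∑[ i < suc k ] atHead (prevF i)
      ≡⟨ ∑-distrib-+ atTail (atHead ∘ prevF) ⟨
    ∑[ i < suc k ] (atTail i + atHead (prevF i))
      ≡⟨ sum-cong-≗ vanishes ⟩
    ∑[ i < suc k ] (+ 0)
      ≡⟨ sum-replicate-zero (suc k) ⟩
    + 0 ∎
    where
    a b : Fin m → ℤ
    a e = incidence G τ v e
    b e = ∑[ i < suc k ] onlyAt (edge i) e (σ i)

    tailEntry headEntry atTail atHead : Fin (suc k) → ℤ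
    tailEntry i = onlyAt (vert i) v (τ (edge i) v ◃ 1)
    headEntry i = onlyAt (vert (nextF i)) v (τ (edge i) v ◃ 1)
    atTail i = tailEntry i * σ i
    atHead i = headEntry i * σ i

    vanishes : ∀ i → atTail i + atHead (prevF i) ≡ + 0
    vanishes i rewrite nextF-prevF i with vert i Fin.≟ v
    ... | yes refl = cancels i
    ... | no _     = refl

  sectionCount≡countUpTo : ∀ i → sectionCount τ w i ≡ countUpTo (unbalanced τ w) (toℕ i)
  sectionCount≡countUpTo i = length-filter-allFin (λ j → does (toℕ j ≤? toℕ i) ∧ unbalanced τ w j)

  sectionCount-zero : sectionCount τ w Fin.zero ≡ indicator (unbalanced τ w Fin.zero)
  sectionCount-zero = trans (sectionCount≡countUpTo Fin.zero) (countUpTo-zero (unbalanced τ w))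

  sectionCount-suc : ∀ j → sectionCount τ w (Fin.suc j)
                           ≡ sectionCount τ w (inject₁ j) ℕ.+ indicator (unbalanced τ w (Fin.suc j))
  sectionCount-suc j = begin
    sectionCount τ w (Fin.suc j)
      ≡⟨ sectionCount≡countUpTo (Fin.suc j) ⟩
    countUpTo (unbalanced τ w) (suc (toℕ j))
      ≡⟨ countUpTo-step (unbalanced τ w) j ⟩
    countUpTo (unbalanced τ w) (toℕ j) ℕ.+ indicator u
      ≡⟨ cong (λ c → countUpTo (unbalanced τ w) c ℕ.+ indicator u) (FinP.toℕ-inject₁ j) ⟨
    countUpTo (unbalanced τ w) (toℕ (inject₁ j)) ℕ.+ indicator u
      ≡⟨ cong (ℕ._+ indicator u) (sectionCount≡countUpTo (inject₁ j)) ⟨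
    sectionCount τ w (inject₁ j) ℕ.+ indicator u ∎
    where
    u : Bool
    u = unbalanced τ w (Fin.suc j)

  sectionCount-last : sectionCount τ w (fromℕ k) ≡ numUnbalanced τ w
  sectionCount-last = begin
    sectionCount τ w (fromℕ k)                 ≡⟨ sectionCount≡countUpTo (fromℕ k) ⟩
    countUpTo (unbalanced τ w) (toℕ (fromℕ k)) ≡⟨ cong (countUpTo (unbalanced τ w)) (FinP.toℕ-fromℕ k) ⟩
    countUpTo (unbalanced τ w) k               ≡⟨ countUpTo-all (unbalanced τ w) k ℕP.≤-refl ⟩
    count (unbalanced τ w)                     ≡⟨ length-filter-allFin (unbalanced τ w) ⟨
    numUnbalanced τ w                          ∎

  isEven-+-indicator : ∀ a b → isEven τ w (a ℕ.+ indicator b) ≡ b xor isEven τ w a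
  isEven-+-indicator a true  = cong (isEven τ w) (ℕP.+-comm a 1)
  isEven-+-indicator a false = cong (isEven τ w) (ℕP.+-identityʳ a)

  sectionParity : Fin (suc k) → Bool
  sectionParity i = isEven τ w (sectionCount τ w i)

  sectionParity-xor : EvenWalk τ w → ∀ i → sectionParity i ≡ unbalanced τ w i xor sectionParity (prevF i)
  sectionParity-xor even Fin.zero = begin
    isEven τ w (sectionCount τ w Fin.zero)
      ≡⟨ cong (isEven τ w) sectionCount-zero ⟩
    isEven τ w (indicator u₀)
      ≡⟨ isEven-+-indicator 0 u₀ ⟩
    u₀ xor true
      ≡⟨ cong (u₀ xor_) (trans (cong (isEven τ w) sectionCount-last) even) ⟨
    u₀ xor sectionParity (fromℕ k) ∎
    where
    u₀ : Bool
    u₀ = unbalanced τ w Fin.zero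
  sectionParity-xor even (Fin.suc j) =
    trans (cong (isEven τ w) (sectionCount-suc j))
          (isEven-+-indicator (sectionCount τ w (inject₁ j)) (unbalanced τ w (Fin.suc j)))

  sectionSigns : Fin (suc k) → ℤ
  sectionSigns = ±1 ∘ sectionParity

  sectionSigns-cancel : EvenWalk τ w → CancelsAtVertexTerms sectionSigns
  sectionSigns-cancel even i rewrite sectionParity-xor even i =
    ±1-xor-cancel (τ (edge i) (vert i)) (τ (edge (prevF i)) (vert i)) (sectionParity (prevF i))

  sectionVector : Vec ℤ m
  sectionVector = edgeTermVector sectionSigns

  sectionVector-inKernel : EvenWalk τ w → InKernel G τ sectionVector
  sectionVector-inKernel even = edgeTermVector-inKernel sectionSigns (sectionSigns-cancel even)

  occurrences : Bool → Fin m → ℕ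
  occurrences p e = count (λ i → does (edge i Fin.≟ e) ∧ does (sectionParity i Bool.≟ p))

  sectionExp≡occurrences : ∀ p → sectionExp τ w p ≡ tabulate (occurrences p)
  sectionExp≡occurrences p =
    tabulate-cong (λ e → length-filter-allFin (λ i → does (edge i Fin.≟ e) ∧ does (sectionParity i Bool.≟ p)))

  minOccurrences : Fin m → ℕ
  minOccurrences e = occurrences true e ℕ.⊓ occurrences false e

  gcdExponent : Monomial m
  gcdExponent = tabulate minOccurrences

  sectionExp-factor : ∀ p (h : ℤ → ℕ) →
    (∀ e → minOccurrences e ℕ.+ h (occurrences true e ⊖ occurrences false e) ≡ occurrences p e) →
    sectionExp τ w p ≡ zipWith ℕ._+_ gcdExponent (Vec.map h sectionVector)
  sectionExp-factor p h split = begin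
    sectionExp τ w p
      ≡⟨ sectionExp≡occurrences p ⟩
    tabulate (occurrences p)
      ≡⟨ tabulate-cong (λ e → trans (cong (λ z → minOccurrences e ℕ.+ h z) (b≡ e)) (split e)) ⟨
    tabulate (λ e → minOccurrences e ℕ.+ h (b e))
      ≡⟨ zipWith-tabulate ℕ._+_ minOccurrences (h ∘ b) ⟨
    zipWith ℕ._+_ gcdExponent (tabulate (h ∘ b))
      ≡⟨ cong (zipWith ℕ._+_ gcdExponent) (tabulate-∘ h b) ⟩
    zipWith ℕ._+_ gcdExponent (Vec.map h sectionVector) ∎
    where
    b : Fin m → ℤ
    b e = ∑[ i < suc k ] onlyAt (edge i) e (sectionSigns i)
    b≡ : ∀ e → b e ≡ occurrences true e ⊖ occurrences false e
    b≡ e = ∑-±1 (λ i → does (edge i Fin.≟ e)) sectionParity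

  evenSectionExp-factor : sectionExp τ w true ≡ zipWith ℕ._+_ gcdExponent (Vec.map pos sectionVector)
  evenSectionExp-factor =
    sectionExp-factor true pos (λ e → m⊓n+pos[m⊖n]≡m (occurrences true e) (occurrences false e))

  oddSectionExp-factor : sectionExp τ w false ≡ zipWith ℕ._+_ gcdExponent (Vec.map neg sectionVector)
  oddSectionExp-factor =
    sectionExp-factor false neg (λ e → m⊓n+neg[m⊖n]≡n (occurrences true e) (occurrences false e))

module _ {c ℓ} (K : CommutativeRing c ℓ) {m : ℕ} where
  open CommutativeRing K using (1#; -_; +-cong; *-identityˡ) renaming (refl to ≈-refl; sym to ≈-sym)
  open Poly K m

  binom-factor : ∀ γ α β → binom (zipWith ℕ._+_ γ α) (zipWith ℕ._+_ γ β) ≈P (mono γ *P binom α β)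
  binom-factor γ α β z
    with does (≡-dec ℕ._≟_ (zipWith ℕ._+_ γ α) z) | does (≡-dec ℕ._≟_ (zipWith ℕ._+_ γ β) z)
  ... | true  | true  = +-cong (≈-sym (*-identityˡ 1#)) (+-cong (≈-sym (*-identityˡ (- 1#))) ≈-refl)
  ... | true  | false = +-cong (≈-sym (*-identityˡ 1#)) ≈-refl
  ... | false | true  = +-cong (≈-sym (*-identityˡ (- 1#))) ≈-refl
  ... | false | false = ≈-refl

mainTheorem6 : ∀ {c ℓ} (K : CommutativeRing c ℓ) → IsField K →
    ∀ {n m : ℕ} (G : SimpleGraph n m) (τ : SignFn n m) (w : ClosedWalk G) →
    EvenWalk τ w → InI K G τ (Bw τ w K)
mainTheorem6 K _ {m = m} G τ w even = generator ∷ [] , Bw≈mono*generator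
  where
  open Poly K m
  b : Vec ℤ m
  b = sectionVector τ w

  γ : Monomial m
  γ = gcdExponent τ w

  generator : Σ (P × P) (λ gs → IsToricGen K G τ (proj₂ gs))
  generator = (mono γ , binom (Vec.map pos b) (Vec.map neg b)) , b , sectionVector-inKernel τ w even , refl

  Bw≈mono*generator : binom (sectionExp τ w true) (sectionExp τ w false)
                        ≈P (mono γ *P binom (Vec.map pos b) (Vec.map neg b))
  Bw≈mono*generator rewrite evenSectionExp-factor τ w | oddSectionExp-factor τ w =
    binom-factor K γ (Vec.map pos b) (Vec.map neg b)
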